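{- Let $\mathcal{U}$ be the union automaton of two Wheeler automata with start state $s$, and run the iterative refining algorithm on $\mathcal{U}$. If, at the beginning of the $j$-th iteration, a partition element $P_i$ is not a singleton and there exists $j'<j$ such that for every $v\in P_i$ all paths from $s$ to $v$ have length $j'$, then $P_i$ is not split by any subsequent refinement step.
   Context: Wheeler graph: a directed edge-labeled graph with a node ordering such that in-degree-$0$ nodes come first and for edges $(u,v)$ labeled $a$, $(u',v')$ labeled $a'$: $a<a'\Rightarrow v<v'$ and $(a=a')\wedge(u<u')\Rightarrow v\le v'$. NFA $(V,E,F,s,\Sigma)$, $\Sigma=\{1,\dots,\sigma\}$, $E\subseteq V\times V\times\Sigma$, $s$ the only state of in-degree $0$, all states reachable from $s$ and able to reach a final state. Wheeler automaton: NFA without $\epsilon$-transitions with a fixed state ordering making its state diagram a Wheeler graph. For Wheeler automata $\mathcal{A}_b=(V_b,E_b,F_b,s_b,\Sigma)$, $b=0,1$, with disjoint state sets, the union automaton has $V=(V_0\setminus\{s_0\})\cup(V_1\setminus\{s_1\})\cup\{s\}$, $E=E_0^*\cup E_1^*$ ($E_b$ with edges leaving $s_b$ redirected to leave $s$), $F=(F_0\setminus\{s_0\})\cup(F_1\setminus\{s_1\})$ plus $s$ if $s_0\in F_0$ or $s_1\in F_1$. A Wheeler C-order is an ordering of $V$ making $\mathcal{U}$ a Wheeler graph and preserving the relative orders of $V_0\setminus\{s_0\}$ and $V_1\setminus\{s_1\}$. For $v\ne s$, $\lambda(v)$ is the label of the edges entering $v$. Iterative refining algorithm: the initial ordered partition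 is $P_0=\{s\}$, $P_c=\{v:\lambda(v)=c\}$, $c=1,\dots,\sigma$ (empty sets discarded). Given the current ordered partition $P_0,\dots,P_k$, the minmax pair of $v\ne s$ is $(\ell,m)$ with $\ell$ (resp. $m$) the smallest (resp. largest) index $t$ such that an edge enters $v$ from a node of $P_t$. Pairs $(\ell,m),(\ell',m')$ are compatible if $m\le\ell'$ or $m'\le\ell$; $(\ell,m)\preceq(\ell',m')$ means $m\le\ell'$. A refinement step (one iteration): for each $i=1,\dots,k$, list $S_0=P_i\cap V_0$ in increasing $\mathcal{A}_0$-order and $S_1=P_i\cap V_1$ in increasing $\mathcal{A}_1$-order and merge them into a list $L$: while both are nonempty, compare their first elements $v\in S_0$, $v'\in S_1$ with minmax pairs $(\ell,m),(\ell',m')$; if incompatible, the algorithm stops reporting that no Wheeler C-order exists; if $(\ell,m)\preceq(\ell',m')$ move $v$ to the end of $L$, else move $v'$; then append the remaining elements. Split $L$ into maximal runs of consecutive nodes with identical minmax pairs. The new ordered partition is $P_0$ followed by the runs from $P_1$, then from $P_2$, ..., then from $P_k$. Iterations are repeated until failure or until a step leaves the partition unchanged. -}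

module Defs where

open import Data.Bool using (Bool; true; false; if_then_else_; not; _∨_; _∧_)
open import Data.Nat using (ℕ; zero; suc; _⊓_; _⊔_; _≤ᵇ_; _≡ᵇ_)
open import Data.Fin as F using (Fin; zero; suc)
open import Data.List using (List; []; _∷_; _++_; map; concat; allFin; filterᵇ; mapMaybe; foldr)
open import Data.Maybe using (Maybe; just; nothing; _>>=_)
import Data.Maybe as M
open import Data.Product using (_×_; _,_; ∃; Σ)
open import Relation.Binary.PropositionalEquality using (_≡_; _≢_; refl)
open import Relation.Nullary using (¬_; Dec; yes; no; does)
open import Data.List.Membership.Propositional using (_∈_; _∉_)

data Path {V L : Set} (E : List (V × L × V)) : V → V → ℕ → Set where
  here : ∀ {v} → Path E v v 0
  step : ∀ {u w v a k} → Path E u w k → (w , a , v) ∈ E → Path E u v (suc k)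

-- NFAs over Σ = {1,…,σ}; label c ∈ Σ is represented by  c - 1 : Fin σ
-- (same order).  States are Fin (suc n); the fixed state ordering is the
-- order of Fin, and the start state is zero (in a Wheeler automaton the
-- start state, the only in-degree-0 state, is necessarily first).

record NFA (σ : ℕ) : Set where
  field
    n     : ℕ
    edges : List (Fin (suc n) × Fin σ × Fin (suc n))
    final : List (Fin (suc n))

  State : Set
  State = Fin (suc n)

  start : State
  start = zero

  InDeg0 : State → Set
  InDeg0 v = ∀ u a → (u , a , v) ∉ edges

record IsWheelerAutomaton {σ : ℕ} (A : NFA σ) : Set where
  open NFA A
  field
    start-indeg0      : InDeg0 start
    only-start-indeg0 : ∀ v → InDeg0 v → v ≡ start
    reachable   : ∀ v → ∃ λ k → Path edges start v k
    coreachable : ∀ v → ∃ λ f → f ∈ final × ∃ λ k → Path edges v f k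
    indeg0-first : ∀ u v → InDeg0 u → ¬ InDeg0 v → u F.< v
    wheeler-label : ∀ {u a v u' a' v'} → (u , a , v) ∈ edges → (u' , a' , v') ∈ edges →
                    a F.< a' → v F.< v'
    wheeler-order : ∀ {u a v u' a' v'} → (u , a , v) ∈ edges → (u' , a' , v') ∈ edges →
                    a ≡ a' → u F.< u' → v F.≤ v'

-- Its states: the new start s, the states of A₀ other
-- than s₀ (inV0 i  stands for state  suc i  of A₀), the states of A₁ other
-- than s₁ (inV1 i  stands for state  suc i  of A₁).

data UNode (n0 n1 : ℕ) : Set where
  ustart : UNode n0 n1
  inV0   : Fin n0 → UNode n0 n1
  inV1   : Fin n1 → UNode n0 n1

_≟ᵤ_ : ∀ {n0 n1} (x y : UNode n0 n1) → Dec (x ≡ y)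
ustart ≟ᵤ ustart = yes refl
ustart ≟ᵤ inV0 _ = no λ ()
ustart ≟ᵤ inV1 _ = no λ ()
inV0 _ ≟ᵤ ustart = no λ ()
inV0 i ≟ᵤ inV0 j with i F.≟ j
... | yes refl = yes refl
... | no i≢j = no λ { refl → i≢j refl }
inV0 _ ≟ᵤ inV1 _ = no λ ()
inV1 _ ≟ᵤ ustart = no λ ()
inV1 _ ≟ᵤ inV0 _ = no λ ()
inV1 i ≟ᵤ inV1 j with i F.≟ j
... | yes refl = yes refl
... | no i≢j = no λ { refl → i≢j refl }

_==ᵤ_ : ∀ {n0 n1} → UNode n0 n1 → UNode n0 n1 → Bool
x ==ᵤ y = does (x ≟ᵤ y)

memb : ∀ {n0 n1} → UNode n0 n1 → List (UNode n0 n1) → Bool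
memb v []       = false
memb v (x ∷ xs) = (v ==ᵤ x) ∨ memb v xs

module Union {σ : ℕ} (A0 A1 : NFA σ) where
  private
    module A0 = NFA A0
    module A1 = NFA A1

  U : Set
  U = UNode A0.n A1.n

  embed0 : Fin (suc A0.n) → U
  embed0 zero    = ustart
  embed0 (suc i) = inV0 i

  embed1 : Fin (suc A1.n) → U
  embed1 zero    = ustart
  embed1 (suc i) = inV1 i

  -- E = E₀* ∪ E₁*  (edges leaving s_b now leave s)
  edges : List (U × Fin σ × U)
  edges = map (λ { (u , a , v) → embed0 u , a , embed0 v }) A0.edges
       ++ map (λ { (u , a , v) → embed1 u , a , embed1 v }) A1.edges

  -- F  (s ∈ F iff s₀ ∈ F₀ or s₁ ∈ F₁)
  final : List U
  final = map embed0 A0.final ++ map embed1 A1.final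

  nonStartNodes : List U
  nonStartNodes = map inV0 (allFin A0.n) ++ map inV1 (allFin A1.n)

  lam : U → Maybe (Fin σ)
  lam v = go edges
    where
      go : List (U × Fin σ × U) → Maybe (Fin σ)
      go [] = nothing
      go ((u , a , w) ∷ es) = if w ==ᵤ v then just a else go es

  Partition : Set
  Partition = List (List U)

  hasLabel : Fin σ → U → Bool
  hasLabel c v with lam v
  ... | nothing = false
  ... | just a  = does (a F.≟ c)

  nonEmpty : List U → Bool
  nonEmpty []      = false
  nonEmpty (_ ∷ _) = true

  initial : Partition
  initial = (ustart ∷ [])
          ∷ filterᵇ nonEmpty (map (λ c → filterᵇ (hasLabel c) nonStartNodes) (allFin σ))

  indexOf : Partition → U → ℕ
  indexOf []       v = 0
  indexOf (b ∷ bs) v = if memb v b then 0 else suc (indexOf bs v)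

  predIndices : Partition → U → List ℕ
  predIndices P v = mapMaybe (λ { (u , a , w) → if w ==ᵤ v then just (indexOf P u) else nothing }) edges

  minL : List ℕ → ℕ
  minL []       = 0
  minL (x ∷ xs) = foldr _⊓_ x xs

  maxL : List ℕ → ℕ
  maxL = foldr _⊔_ 0

  minmax : Partition → U → ℕ × ℕ
  minmax P v = minL (predIndices P v) , maxL (predIndices P v)

  compatible : ℕ × ℕ → ℕ × ℕ → Bool
  compatible (l , m) (l' , m') = (m ≤ᵇ l') ∨ (m' ≤ᵇ l)

  precedes : ℕ × ℕ → ℕ × ℕ → Bool
  precedes (l , m) (l' , m') = m ≤ᵇ l'

  samePair : ℕ × ℕ → ℕ × ℕ → Bool
  samePair (l , m) (l' , m') = (l ≡ᵇ l') ∧ (m ≡ᵇ m')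

  -- merging S₀ and S₁; nothing = the algorithm stops reporting failure
  merge : Partition → List U → List U → Maybe (List U)
  merge P []       ys       = just ys
  merge P (x ∷ xs) []       = just (x ∷ xs)
  merge P (x ∷ xs) (y ∷ ys) =
    if not (compatible (minmax P x) (minmax P y)) then nothing
    else (if precedes (minmax P x) (minmax P y)
          then M.map (x ∷_) (merge P xs (y ∷ ys))
          else M.map (y ∷_) (merge P (x ∷ xs) ys))

  runs : Partition → List U → List (List U)
  runs P [] = []
  runs P (x ∷ xs) with runs P xs
  ... | [] = (x ∷ []) ∷ []
  ... | [] ∷ gs = (x ∷ []) ∷ [] ∷ gs
  ... | (y ∷ g) ∷ gs =
    if samePair (minmax P x) (minmax P y)
    then (x ∷ y ∷ g) ∷ gs
    else (x ∷ []) ∷ (y ∷ g) ∷ gs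

  refineBlock : Partition → List U → Maybe (List (List U))
  refineBlock P B =
    M.map (runs P)
      (merge P (filterᵇ (λ v → memb v B) (map inV0 (allFin A0.n)))
               (filterᵇ (λ v → memb v B) (map inV1 (allFin A1.n))))

  mapM : (List U → Maybe (List (List U))) → List (List U) → Maybe (List (List (List U)))
  mapM f []       = just []
  mapM f (b ∷ bs) = f b >>= λ r → M.map (r ∷_) (mapM f bs)

  refineStep : Partition → Maybe Partition
  refineStep []        = just []
  refineStep (p0 ∷ ps) = M.map (λ rs → p0 ∷ concat rs) (mapM (refineBlock (p0 ∷ ps)) ps)

  -- partition after t refinement steps (nothing = failure occurred);
  -- once a step leaves the partition unchanged, further steps keep it fixed
  run : ℕ → Maybe Partition
  run zero    = just initial
  run (suc t) = run t >>= refineStep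

  -- the partition at the beginning of the j-th iteration (j ≥ 1)
  partitionAtIteration : ℕ → Maybe Partition
  partitionAtIteration j = run (j Data.Nat.∸ 1)

NonSingleton : {A : Set} → List A → Set
NonSingleton {A} B = Σ A λ u → Σ A λ v → u ∈ B × v ∈ B × u ≢ v

{-# OPTIONS --safe #-}
module Submission where

-- A refinement step puts two nodes in one block only if they had the same minmax pair, and it
-- keeps the strict order of the existing blocks. Let every path from s to u have length d, so
-- that every predecessor of u has depth d - 1; by induction on d, the blocks of u's predecessors
-- are never split after step d - 1. The minmax pair of a node is read off the extreme blocks of
-- its predecessors, and those blocks keep both their content and their relative order. So the
-- nodes of u's block after step d, which shared u's pair at step d - 1, share it at every later
-- step too; and a block all of whose nodes share one pair is never split.

open import Defs

open import Algebra.Definitions using (Selective)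
open import Data.Bool using (Bool; true; false; T; if_then_else_)
open import Data.Bool.Properties using (T-≡)
open import Data.Fin as Fin using (Fin)
open import Data.List
  using (List; []; _∷_; _++_; concat; length; map; mapMaybe; foldr; allFin; filterᵇ)
open import Data.List.Membership.Propositional using (_∈_; _∉_)
open import Data.List.Membership.Propositional.Properties
  using ( ∈-++⁺ˡ; ∈-++⁺ʳ; ∈-++⁻; ∈-map⁺; ∈-map⁻; ∈-concat⁺′; ∈-concat⁻′
        ; ∈-filter⁺; ∈-filter⁻; ∈-allFin)
open import Data.List.Properties using (concat-++; filter-++; ++-identityʳ)
open import Data.List.Relation.Binary.Disjoint.Propositional using (Disjoint)
open import Data.List.Relation.Binary.Permutation.Propositional
  using (_↭_; prep; ↭-refl; ↭-sym; ↭-trans; ↭-reflexive; ↭⇒↭ₛ)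
open import Data.List.Relation.Binary.Permutation.Propositional.Properties using (∈-resp-↭; shift)
import Data.List.Relation.Binary.Permutation.Setoid.Properties as Permutationₛ
open import Data.List.Relation.Binary.Pointwise as Pointwise using (Pointwise; []; _∷_)
open import Data.List.Relation.Unary.All as All using (All; []; _∷_)
import Data.List.Relation.Unary.All.Properties as Allₚ
open import Data.List.Relation.Unary.AllPairs as AllPairs using ([]; _∷_)
import Data.List.Relation.Unary.AllPairs.Properties as AllPairsₚ
open import Data.List.Relation.Unary.Any using (here; there)
open import Data.List.Relation.Unary.Unique.Propositional using (Unique)
import Data.List.Relation.Unary.Unique.Propositional.Properties as Unique
open import Data.Maybe as Maybe using (Maybe; just; nothing; _>>=_)
open import Data.Maybe.Properties using (just-injective)
open import Data.Nat
  using (ℕ; zero; suc; z≤n; s≤s; s≤s⁻¹; _≤_; _<_; _+_; _∸_; _⊓_; _⊔_; _≡ᵇ_)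
open import Data.Nat.Properties
open import Data.Product using (Σ; ∃; _×_; _,_; proj₁; proj₂)
open import Data.Sum using (inj₁; inj₂)
open import Function using (_∘_; Equivalence)
open import Relation.Binary.Definitions using (tri<; tri≈; tri>)
open import Relation.Binary.PropositionalEquality
open import Relation.Nullary using (yes; no; contradiction)
open import Relation.Nullary.Decidable using (T?; dec-true)

==ᵤ-refl : ∀ {n0 n1} (x : UNode n0 n1) → (x ==ᵤ x) ≡ true
==ᵤ-refl x = dec-true (x ≟ᵤ x) refl

memb⇒∈ : ∀ {n0 n1} {x : UNode n0 n1} b → memb x b ≡ true → x ∈ b
memb⇒∈ {x = x} (y ∷ b) e with x ≟ᵤ y
... | yes x≡y = here x≡y
... | no _ = there (memb⇒∈ b e)

∈⇒memb : ∀ {n0 n1} {x : UNode n0 n1} {b} → x ∈ b → memb x b ≡ true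
∈⇒memb {x = x} (here refl) rewrite ==ᵤ-refl x = refl
∈⇒memb {x = x} {y ∷ _} (there x∈b) with x ==ᵤ y
... | true = refl
... | false = ∈⇒memb x∈b

memb≡false⇒∉ : ∀ {n0 n1} {x : UNode n0 n1} {b} → memb x b ≡ false → x ∉ b
memb≡false⇒∉ e x∈b with () ← trans (sym e) (∈⇒memb x∈b)

∉-++⁻ : ∀ {A : Set} {x : A} xs {ys} → x ∉ xs → x ∈ xs ++ ys → x ∈ ys
∉-++⁻ xs x∉xs x∈ with ∈-++⁻ xs x∈
... | inj₁ x∈xs = contradiction x∈xs x∉xs
... | inj₂ x∈ys = x∈ys

∈-mapMaybe⁻ : ∀ {A B : Set} (f : A → Maybe B) xs {y} → y ∈ mapMaybe f xs →
  ∃ λ x → x ∈ xs × f x ≡ just y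
∈-mapMaybe⁻ f (x ∷ xs) y∈ with f x in fx
∈-mapMaybe⁻ f (x ∷ xs) (here refl) | just _ = x , here refl , fx
∈-mapMaybe⁻ f (x ∷ xs) (there y∈) | just _ =
  let x′ , x′∈ , fx′ = ∈-mapMaybe⁻ f xs y∈ in x′ , there x′∈ , fx′
∈-mapMaybe⁻ f (x ∷ xs) y∈ | nothing =
  let x′ , x′∈ , fx′ = ∈-mapMaybe⁻ f xs y∈ in x′ , there x′∈ , fx′

∈-mapMaybe⁺ : ∀ {A B : Set} (f : A → Maybe B) xs {x y} → x ∈ xs → f x ≡ just y →
  y ∈ mapMaybe f xs
∈-mapMaybe⁺ f (x ∷ xs) (here refl) fx rewrite fx = here refl
∈-mapMaybe⁺ f (x ∷ xs) (there x∈) fx with f x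
... | just _ = there (∈-mapMaybe⁺ f xs x∈ fx)
... | nothing = ∈-mapMaybe⁺ f xs x∈ fx

Unique-++⁻ʳ : ∀ {A : Set} (xs : List A) {ys} → Unique (xs ++ ys) → Unique ys
Unique-++⁻ʳ [] u = u
Unique-++⁻ʳ (x ∷ xs) (_ ∷ u) = Unique-++⁻ʳ xs u

Unique-++⇒Disjoint : ∀ {A : Set} (xs : List A) {ys} → Unique (xs ++ ys) → Disjoint xs ys
Unique-++⇒Disjoint (x ∷ xs) (x∉ ∷ _) (here refl , v∈ys) = All.lookup x∉ (∈-++⁺ʳ xs v∈ys) refl
Unique-++⇒Disjoint (x ∷ xs) (_ ∷ u) (there v∈xs , v∈ys) = Unique-++⇒Disjoint xs u (v∈xs , v∈ys)

map≡just⁻ : ∀ {A B : Set} {f : A → B} m {y} → Maybe.map f m ≡ just y →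
  ∃ λ x → m ≡ just x × y ≡ f x
map≡just⁻ (just x) refl = x , refl , refl

>>=≡just⁻ : ∀ {A B : Set} (m : Maybe A) {f : A → Maybe B} {y} → (m >>= f) ≡ just y →
  ∃ λ x → m ≡ just x × f x ≡ just y
>>=≡just⁻ (just x) e = x , refl , e

<-preserving⇒≡-reflecting : ∀ {A : Set} (f g : A → ℕ) → (∀ a b → f a < f b → g a < g b) →
  ∀ a b → g a ≡ g b → f a ≡ f b
<-preserving⇒≡-reflecting f g mono a b ga≡gb with <-cmp (f a) (f b)
... | tri< fa<fb _ _ = contradiction ga≡gb (<⇒≢ (mono a b fa<fb))
... | tri≈ _ fa≡fb _ = fa≡fb
... | tri> _ _ fb<fa = contradiction (sym ga≡gb) (<⇒≢ (mono b a fb<fa))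

foldr-selective : ∀ {A : Set} {_∙_ : A → A → A} → Selective _≡_ _∙_ →
  ∀ e xs → foldr _∙_ e xs ∈ e ∷ xs
foldr-selective sel e [] = here refl
foldr-selective {_∙_ = _∙_} sel e (x ∷ xs) with sel x (foldr _∙_ e xs)
... | inj₁ eq = there (here eq)
... | inj₂ eq with foldr-selective sel e xs
...   | here p = here (trans eq p)
...   | there p = there (there (subst (_∈ xs) (sym eq) p))

foldr-⊓-≤ : ∀ {n} x xs → n ∈ x ∷ xs → foldr _⊓_ x xs ≤ n
foldr-⊓-≤ x [] (here refl) = ≤-refl
foldr-⊓-≤ x (y ∷ ys) (here refl) = ≤-trans (m⊓n≤n y _) (foldr-⊓-≤ x ys (here refl))
foldr-⊓-≤ x (y ∷ ys) (there (here refl)) = m⊓n≤m y _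
foldr-⊓-≤ x (y ∷ ys) (there (there n∈)) = ≤-trans (m⊓n≤n y _) (foldr-⊓-≤ x ys (there n∈))

foldr-⊔-≥ : ∀ {n} xs → n ∈ xs → n ≤ foldr _⊔_ 0 xs
foldr-⊔-≥ (x ∷ xs) (here refl) = m≤m⊔n x _
foldr-⊔-≥ (x ∷ xs) (there n∈) = ≤-trans (foldr-⊔-≥ xs n∈) (m≤n⊔m x _)

foldr-⊔-∈ : ∀ x xs → foldr _⊔_ 0 (x ∷ xs) ∈ x ∷ xs
foldr-⊔-∈ x xs with foldr-selective ⊔-sel 0 (x ∷ xs)
... | there m∈ = m∈
... | here m≡0 = here (≤-antisym (subst (_≤ x) (sym m≡0) z≤n) (foldr-⊔-≥ (x ∷ xs) (here refl)))

module Refinement {σ : ℕ} (A0 A1 : NFA σ) where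
  open Union A0 A1

  minL-≤ : ∀ l {n} → n ∈ l → minL l ≤ n
  minL-≤ (x ∷ xs) = foldr-⊓-≤ x xs

  minL-∈ : ∀ l {n} → n ∈ l → minL l ∈ l
  minL-∈ (x ∷ xs) _ = foldr-selective ⊓-sel x xs

  maxL-≥ : ∀ l {n} → n ∈ l → n ≤ maxL l
  maxL-≥ l = foldr-⊔-≥ l

  maxL-∈ : ∀ l {n} → n ∈ l → maxL l ∈ l
  maxL-∈ (x ∷ xs) _ = foldr-⊔-∈ x xs

  minL-unique : ∀ l {m} → m ∈ l → (∀ {n} → n ∈ l → m ≤ n) → minL l ≡ m
  minL-unique l m∈ m≤ = ≤-antisym (minL-≤ l m∈) (m≤ (minL-∈ l m∈))

  maxL-unique : ∀ l {m} → m ∈ l → (∀ {n} → n ∈ l → n ≤ m) → maxL l ≡ m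
  maxL-unique l m∈ ≤m = ≤-antisym (≤m (maxL-∈ l m∈)) (maxL-≥ l m∈)

  -- Block indices

  indexOf-∷-∈ : ∀ {b} G {x} → x ∈ b → indexOf (b ∷ G) x ≡ 0
  indexOf-∷-∈ G x∈b rewrite ∈⇒memb x∈b = refl

  indexOf-∷-∉ : ∀ {b} G {x} → x ∉ b → indexOf (b ∷ G) x ≡ suc (indexOf G x)
  indexOf-∷-∉ {b} G {x} x∉b with memb x b in e
  ... | true = contradiction (memb⇒∈ b e) x∉b
  ... | false = refl

  indexOf-∷-suc⁻ : ∀ b G {x n} → indexOf (b ∷ G) x ≡ suc n → x ∉ b × indexOf G x ≡ n
  indexOf-∷-suc⁻ b G {x} h with memb x b in e
  ... | false = memb≡false⇒∉ e , suc-injective h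

  indexOf<length : ∀ G {x} → x ∈ concat G → indexOf G x < length G
  indexOf<length (b ∷ G) {x} x∈ with memb x b in e
  ... | true = s≤s z≤n
  ... | false = s≤s (indexOf<length G (∉-++⁻ b (memb≡false⇒∉ e) x∈))

  indexOf-++ˡ : ∀ G H {x} → x ∈ concat G → indexOf (G ++ H) x ≡ indexOf G x
  indexOf-++ˡ (b ∷ G) H {x} x∈ with memb x b in e
  ... | true = refl
  ... | false = cong suc (indexOf-++ˡ G H (∉-++⁻ b (memb≡false⇒∉ e) x∈))

  indexOf-++ʳ : ∀ G H {x} → x ∉ concat G → indexOf (G ++ H) x ≡ length G + indexOf H x
  indexOf-++ʳ [] H x∉ = refl
  indexOf-++ʳ (b ∷ G) H {x} x∉ with memb x b in e
  ... | true = contradiction (∈-++⁺ˡ (memb⇒∈ b e)) x∉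
  ... | false = cong suc (indexOf-++ʳ G H (x∉ ∘ ∈-++⁺ʳ b))

  indexOf-++-< : ∀ G H {x y} → x ∈ concat G → y ∉ concat G →
    indexOf (G ++ H) x < indexOf (G ++ H) y
  indexOf-++-< G H x∈ y∉ rewrite indexOf-++ˡ G H x∈ | indexOf-++ʳ G H y∉ =
    ≤-trans (indexOf<length G x∈) (m≤m+n (length G) _)

  sameIndex⇒sameBlock : ∀ G {x} → x ∈ concat G →
    ∃ λ g → g ∈ G × x ∈ g × (∀ {y} → y ∈ concat G → indexOf G y ≡ indexOf G x → y ∈ g)
  sameIndex⇒sameBlock (b ∷ G) {x} x∈ with memb x b in e
  ... | true = b , here refl , memb⇒∈ b e , sameAsX
    where
      sameAsX : ∀ {y} → y ∈ concat (b ∷ G) → indexOf (b ∷ G) y ≡ 0 → y ∈ b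
      sameAsX {y} _ h with memb y b in e′
      ... | true = memb⇒∈ b e′
  ... | false =
    let g , g∈ , x∈g , sameAsX = sameIndex⇒sameBlock G (∉-++⁻ b (memb≡false⇒∉ e) x∈)
    in g , there g∈ , x∈g ,
       λ y∈ h → let y∉b , h′ = indexOf-∷-suc⁻ b G h in sameAsX (∉-++⁻ b y∉b y∈) h′

  sameBlock⇒sameIndex : ∀ G → Unique (concat G) → ∀ {g x y} → g ∈ G → x ∈ g → y ∈ g →
    indexOf G x ≡ indexOf G y
  sameBlock⇒sameIndex (b ∷ G) u (here refl) x∈ y∈ =
    trans (indexOf-∷-∈ G x∈) (sym (indexOf-∷-∈ G y∈))
  sameBlock⇒sameIndex (b ∷ G) u (there g∈) x∈ y∈ =
    trans (indexOf-∷-∉ G (outside x∈))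
      (trans (cong suc (sameBlock⇒sameIndex G (Unique-++⁻ʳ b u) g∈ x∈ y∈))
        (sym (indexOf-∷-∉ G (outside y∈))))
    where
      outside : ∀ {v} → v ∈ _ → v ∉ b
      outside v∈g v∈b = Unique-++⇒Disjoint b u (v∈b , ∈-concat⁺′ v∈g g∈)

  indexOf-start : ∀ G {x} → x ≢ ustart → indexOf ((ustart ∷ []) ∷ G) x ≡ suc (indexOf G x)
  indexOf-start G {ustart} x≢s = contradiction refl x≢s
  indexOf-start G {inV0 _} _ = refl
  indexOf-start G {inV1 _} _ = refl

  indexOf-start≡0 : ∀ G {x} → indexOf ((ustart ∷ []) ∷ G) x ≡ 0 → x ≡ ustart
  indexOf-start≡0 G {ustart} _ = refl

  -- Runs, merging and the refinement of one block

  samePair-sound : ∀ {p q} → samePair p q ≡ true → p ≡ q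
  samePair-sound {l , m} {l′ , m′} e with l ≡ᵇ l′ in el | m ≡ᵇ m′ in em
  ... | true | true =
    cong₂ _,_ (≡ᵇ⇒≡ l l′ (Equivalence.from T-≡ el)) (≡ᵇ⇒≡ m m′ (Equivalence.from T-≡ em))

  samePair-refl : ∀ p → samePair p p ≡ true
  samePair-refl (l , m)
    rewrite Equivalence.to T-≡ (≡⇒≡ᵇ l l refl) | Equivalence.to T-≡ (≡⇒≡ᵇ m m refl) = refl

  concat-runs : ∀ P L → concat (runs P L) ≡ L
  concat-runs P [] = refl
  concat-runs P (x ∷ xs) with runs P xs | concat-runs P xs
  ... | [] | ih = cong (x ∷_) ih
  ... | [] ∷ gs | ih = cong (x ∷_) ih
  ... | (y ∷ g) ∷ gs | ih with samePair (minmax P x) (minmax P y)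
  ... | true = cong (x ∷_) ih
  ... | false = cong (x ∷_) ih

  ConstantPair : Partition → List U → Set
  ConstantPair P g = ∃ λ c → All (λ v → minmax P v ≡ c) g

  runs-constantPair : ∀ P L → All (ConstantPair P) (runs P L)
  runs-constantPair P [] = []
  runs-constantPair P (x ∷ xs) with runs P xs | runs-constantPair P xs
  ... | [] | _ = (_ , refl ∷ []) ∷ []
  ... | [] ∷ gs | ih = (_ , refl ∷ []) ∷ ih
  ... | (y ∷ g) ∷ gs | (c , py ∷ pg) ∷ ih with samePair (minmax P x) (minmax P y) in e
  ... | true = (c , trans (samePair-sound e) py ∷ py ∷ pg) ∷ ih
  ... | false = (_ , refl ∷ []) ∷ (c , py ∷ pg) ∷ ih

  runs-sameIndex⇒samePair : ∀ P L {x y} → x ∈ L → y ∈ L →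
    indexOf (runs P L) x ≡ indexOf (runs P L) y → minmax P x ≡ minmax P y
  runs-sameIndex⇒samePair P L x∈ y∈ h =
    let g , g∈ , x∈g , sameAsX = sameIndex⇒sameBlock (runs P L) (∈-concat-runs x∈)
        y∈g = sameAsX (∈-concat-runs y∈) (sym h)
        c , pairs≡c = All.lookup (runs-constantPair P L) g∈
    in trans (All.lookup pairs≡c x∈g) (sym (All.lookup pairs≡c y∈g))
    where
      ∈-concat-runs : ∀ {v} → v ∈ L → v ∈ concat (runs P L)
      ∈-concat-runs = subst (_ ∈_) (sym (concat-runs P L))

  runs-uniform : ∀ P {c} w L → All (λ v → minmax P v ≡ c) (w ∷ L) →
    runs P (w ∷ L) ≡ (w ∷ L) ∷ []
  runs-uniform P w [] _ = refl
  runs-uniform P w (v ∷ L) (pw ∷ pL)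
    rewrite runs-uniform P v L pL
          | trans (cong (samePair (minmax P w)) (trans (All.head pL) (sym pw)))
                  (samePair-refl (minmax P w)) = refl

  runs-uniform-indexOf : ∀ P {c} L {x} → All (λ v → minmax P v ≡ c) L → x ∈ L →
    indexOf (runs P L) x ≡ 0
  runs-uniform-indexOf P (w ∷ L) pL x∈ rewrite runs-uniform P w L pL | ∈⇒memb x∈ = refl

  merge-↭ : ∀ P xs ys {L} → merge P xs ys ≡ just L → L ↭ xs ++ ys
  merge-↭ P [] ys refl = ↭-refl
  merge-↭ P (x ∷ xs) [] refl = ↭-reflexive (sym (++-identityʳ (x ∷ xs)))
  merge-↭ P (x ∷ xs) (y ∷ ys) e
    with precedes (minmax P x) (minmax P y) | precedes (minmax P y) (minmax P x)
  ... | true | _ with map≡just⁻ {f = x ∷_} (merge P xs (y ∷ ys)) e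
  ...   | L , e′ , refl = prep x (merge-↭ P xs (y ∷ ys) e′)
  merge-↭ P (x ∷ xs) (y ∷ ys) e | false | true with map≡just⁻ {f = y ∷_} (merge P (x ∷ xs) ys) e
  ...   | L , e′ , refl = ↭-trans (prep y (merge-↭ P (x ∷ xs) ys e′)) (↭-sym (shift y (x ∷ xs) ys))

  nodes₀ nodes₁ : List U
  nodes₀ = map inV0 (allFin (NFA.n A0))
  nodes₁ = map inV1 (allFin (NFA.n A1))

  nonStartNodes-≢ : ∀ {v} → v ∈ nonStartNodes → v ≢ ustart
  nonStartNodes-≢ v∈ with ∈-++⁻ nodes₀ v∈
  ... | inj₁ v∈₀ with ∈-map⁻ inV0 v∈₀
  ...   | _ , _ , refl = λ ()
  nonStartNodes-≢ v∈ | inj₂ v∈₁ with ∈-map⁻ inV1 v∈₁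
  ...   | _ , _ , refl = λ ()

  ∈-nonStartNodes : ∀ {v} → v ≢ ustart → v ∈ nonStartNodes
  ∈-nonStartNodes {ustart} v≢s = contradiction refl v≢s
  ∈-nonStartNodes {inV0 i} _ = ∈-++⁺ˡ (∈-map⁺ inV0 (∈-allFin i))
  ∈-nonStartNodes {inV1 i} _ = ∈-++⁺ʳ nodes₀ (∈-map⁺ inV1 (∈-allFin i))

  Unique-nonStartNodes : Unique nonStartNodes
  Unique-nonStartNodes =
    Unique.++⁺ (Unique.map⁺ (λ { refl → refl }) (Unique.allFin⁺ _))
               (Unique.map⁺ (λ { refl → refl }) (Unique.allFin⁺ _))
               disjoint
    where
      disjoint : Disjoint nodes₀ nodes₁
      disjoint (v∈₀ , v∈₁) with ∈-map⁻ inV0 v∈₀ | ∈-map⁻ inV1 v∈₁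
      ... | _ , _ , refl | _ , _ , ()

  inBlock : List U → U → Bool
  inBlock b v = memb v b

  membersOf₀ membersOf₁ membersOf : List U → List U
  membersOf₀ b = filterᵇ (inBlock b) nodes₀
  membersOf₁ b = filterᵇ (inBlock b) nodes₁
  membersOf b = filterᵇ (inBlock b) nonStartNodes

  ∈-membersOf⁻ : ∀ {b v} → v ∈ membersOf b → v ∈ b × v ≢ ustart
  ∈-membersOf⁻ {b} v∈ =
    let v∈ns , inB = ∈-filter⁻ (T? ∘ inBlock b) v∈
    in memb⇒∈ b (Equivalence.to T-≡ inB) , nonStartNodes-≢ v∈ns

  ∈-membersOf⁺ : ∀ {b v} → v ∈ b → v ≢ ustart → v ∈ membersOf b
  ∈-membersOf⁺ {b} v∈b v≢s =
    ∈-filter⁺ (T? ∘ inBlock b) (∈-nonStartNodes v≢s) (Equivalence.from T-≡ (∈⇒memb v∈b))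

  -- Of the merge that orders a block only one fact is ever used: it permutes the block's members.
  data RunsOf (P : Partition) (b : List U) : List (List U) → Set where
    runsOf : ∀ {L} → L ↭ membersOf b → RunsOf P b (runs P L)

  refineBlock⇒RunsOf : ∀ {P b r} → refineBlock P b ≡ just r → RunsOf P b r
  refineBlock⇒RunsOf {P} {b} e with map≡just⁻ {f = runs P} (merge P (membersOf₀ b) (membersOf₁ b)) e
  ... | L , merged , refl =
    runsOf (↭-trans (merge-↭ P (membersOf₀ b) (membersOf₁ b) merged)
                    (↭-reflexive (sym (filter-++ (T? ∘ inBlock b) nodes₀ nodes₁))))

  module _ {P : Partition} {b : List U} where

    RunsOf-∈⁻ : ∀ {r x} → RunsOf P b r → x ∈ concat r → x ∈ b × x ≢ ustart
    RunsOf-∈⁻ (runsOf {L} perm) x∈ =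
      ∈-membersOf⁻ (∈-resp-↭ perm (subst (_ ∈_) (concat-runs P L) x∈))

    RunsOf-∈⁺ : ∀ {r x} → RunsOf P b r → x ∈ b → x ≢ ustart → x ∈ concat r
    RunsOf-∈⁺ (runsOf {L} perm) x∈b x≢s =
      subst (_ ∈_) (sym (concat-runs P L)) (∈-resp-↭ (↭-sym perm) (∈-membersOf⁺ x∈b x≢s))

    RunsOf-memb : ∀ {r x} → RunsOf P b r → (x ∈ b → x ≢ ustart) → memb x b ≡ true → x ∈ concat r
    RunsOf-memb R nonStart e = RunsOf-∈⁺ R (memb⇒∈ b e) (nonStart (memb⇒∈ b e))

    RunsOf-¬memb : ∀ {r x} → RunsOf P b r → memb x b ≡ false → x ∉ concat r
    RunsOf-¬memb R e x∈r = memb≡false⇒∉ e (proj₁ (RunsOf-∈⁻ R x∈r))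

    RunsOf-unique : ∀ {r} → RunsOf P b r → Unique (concat r)
    RunsOf-unique (runsOf {L} perm) =
      subst Unique (sym (concat-runs P L))
        (Permutationₛ.Unique-resp-↭ (setoid U) (↭⇒↭ₛ (↭-sym perm))
          (Unique.filter⁺ _ Unique-nonStartNodes))

    RunsOf-sameIndex⇒samePair : ∀ {r x y} → RunsOf P b r → x ∈ concat r → y ∈ concat r →
      indexOf r x ≡ indexOf r y → minmax P x ≡ minmax P y
    RunsOf-sameIndex⇒samePair (runsOf {L} _) x∈ y∈ =
      runs-sameIndex⇒samePair P L (subst (_ ∈_) (concat-runs P L) x∈)
        (subst (_ ∈_) (concat-runs P L) y∈)

    RunsOf-uniform : ∀ {r c x} → RunsOf P b r → (∀ {y} → y ∈ concat r → minmax P y ≡ c) →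
      x ∈ concat r → indexOf r x ≡ 0
    RunsOf-uniform (runsOf {L} _) pair≡c x∈ =
      runs-uniform-indexOf P L (All.tabulate (pair≡c ∘ subst (_ ∈_) (sym (concat-runs P L))))
        (subst (_ ∈_) (concat-runs P L) x∈)

  -- One refinement step

  NonStart : List (List U) → Set
  NonStart G = ∀ {x} → x ∈ concat G → x ≢ ustart

  module Blockwise {P : Partition} where

    refined-∈⁻ : ∀ {qs rs x} → Pointwise (RunsOf P) qs rs → x ∈ concat (concat rs) → x ∈ concat qs
    refined-∈⁻ {b ∷ qs} {r ∷ rs} (R ∷ Rs) x∈
      with ∈-++⁻ (concat r) (subst (_ ∈_) (sym (concat-++ r (concat rs))) x∈)
    ... | inj₁ x∈r = ∈-++⁺ˡ (proj₁ (RunsOf-∈⁻ R x∈r))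
    ... | inj₂ x∈rs = ∈-++⁺ʳ b (refined-∈⁻ Rs x∈rs)

    refined-∈⁺ : ∀ {qs rs x} → Pointwise (RunsOf P) qs rs → NonStart qs → x ∈ concat qs →
      x ∈ concat (concat rs)
    refined-∈⁺ {b ∷ qs} {r ∷ rs} (R ∷ Rs) nonStart x∈ =
      subst (_ ∈_) (concat-++ r (concat rs)) (split (∈-++⁻ b x∈))
      where
        split : _ → _ ∈ concat r ++ concat (concat rs)
        split (inj₁ x∈b) = ∈-++⁺ˡ (RunsOf-∈⁺ R x∈b (nonStart x∈))
        split (inj₂ x∈qs) = ∈-++⁺ʳ (concat r) (refined-∈⁺ Rs (nonStart ∘ ∈-++⁺ʳ b) x∈qs)

    refined-unique : ∀ {qs rs} → Pointwise (RunsOf P) qs rs → Unique (concat qs) →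
      Unique (concat (concat rs))
    refined-unique [] _ = []
    refined-unique {b ∷ qs} {r ∷ rs} (R ∷ Rs) u =
      subst Unique (concat-++ r (concat rs))
        (Unique.++⁺ (RunsOf-unique R) (refined-unique Rs (Unique-++⁻ʳ b u))
          (λ (x∈r , x∈rs) →
            Unique-++⇒Disjoint b u (proj₁ (RunsOf-∈⁻ R x∈r) , refined-∈⁻ Rs x∈rs)))

    refined-< : ∀ {qs rs} → Pointwise (RunsOf P) qs rs → NonStart qs → ∀ x y →
      indexOf qs x < indexOf qs y → indexOf (concat rs) x < indexOf (concat rs) y
    refined-< [] _ _ _ ()
    refined-< {b ∷ qs} {r ∷ rs} (R ∷ Rs) nonStart x y h with memb x b in ex | memb y b in ey
    refined-< (R ∷ Rs) nonStart x y () | true | true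
    refined-< (R ∷ Rs) nonStart x y () | false | true
    ... | true | false =
      indexOf-++-< r (concat rs) (RunsOf-memb R (nonStart ∘ ∈-++⁺ˡ) ex) (RunsOf-¬memb R ey)
    ... | false | false =
      subst₂ _<_ (sym (indexOf-++ʳ r (concat rs) (RunsOf-¬memb R ex)))
                 (sym (indexOf-++ʳ r (concat rs) (RunsOf-¬memb R ey)))
        (+-monoʳ-< (length r) (refined-< Rs (nonStart ∘ ∈-++⁺ʳ b) x y (s≤s⁻¹ h)))

    refined-samePair : ∀ {qs rs} → Pointwise (RunsOf P) qs rs → NonStart qs → ∀ {x y} →
      x ∈ concat qs → indexOf (concat rs) x ≡ indexOf (concat rs) y → minmax P x ≡ minmax P y
    refined-samePair {b ∷ qs} {r ∷ rs} (R ∷ Rs) nonStart {x} {y} x∈ h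
      with memb x b in ex | memb y b in ey
    ... | true | true =
      let x∈r = RunsOf-memb R (nonStart ∘ ∈-++⁺ˡ) ex
          y∈r = RunsOf-memb R (nonStart ∘ ∈-++⁺ˡ) ey
      in RunsOf-sameIndex⇒samePair R x∈r y∈r
           (trans (sym (indexOf-++ˡ r _ x∈r)) (trans h (indexOf-++ˡ r _ y∈r)))
    ... | true | false =
      contradiction h
        (<⇒≢ (indexOf-++-< r (concat rs) (RunsOf-memb R (nonStart ∘ ∈-++⁺ˡ) ex) (RunsOf-¬memb R ey)))
    ... | false | true =
      contradiction (sym h)
        (<⇒≢ (indexOf-++-< r (concat rs) (RunsOf-memb R (nonStart ∘ ∈-++⁺ˡ) ey) (RunsOf-¬memb R ex)))
    ... | false | false =
      refined-samePair Rs (nonStart ∘ ∈-++⁺ʳ b) (∉-++⁻ b (memb≡false⇒∉ ex) x∈)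
        (+-cancelˡ-≡ (length r) _ _
          (trans (sym (indexOf-++ʳ r _ (RunsOf-¬memb R ex))) (trans h (indexOf-++ʳ r _ (RunsOf-¬memb R ey)))))

    refined-uniform : ∀ {qs rs} → Pointwise (RunsOf P) qs rs → NonStart qs → Unique (concat qs) →
      ∀ {a c} → (∀ {y} → y ∈ concat qs → indexOf qs y ≡ indexOf qs a → minmax P y ≡ c) →
      ∀ {z} → indexOf qs z ≡ indexOf qs a → indexOf (concat rs) z ≡ indexOf (concat rs) a
    refined-uniform [] _ _ _ _ = refl
    refined-uniform {b ∷ qs} {r ∷ rs} (R ∷ Rs) nonStart u {a} {c} pair≡c {z} h
      with memb a b in ea | memb z b in ez
    refined-uniform (R ∷ Rs) nonStart u pair≡c () | true | false
    refined-uniform (R ∷ Rs) nonStart u pair≡c () | false | true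
    ... | true | true =
      let a∈r = RunsOf-memb R (nonStart ∘ ∈-++⁺ˡ) ea
          z∈r = RunsOf-memb R (nonStart ∘ ∈-++⁺ˡ) ez
          r-pair≡c : ∀ {y} → y ∈ concat r → minmax P y ≡ c
          r-pair≡c y∈r =
            let y∈b = proj₁ (RunsOf-∈⁻ R y∈r) in pair≡c (∈-++⁺ˡ y∈b) (indexOf-∷-∈ qs y∈b)
      in trans (indexOf-++ˡ r _ z∈r)
           (trans (trans (RunsOf-uniform R r-pair≡c z∈r) (sym (RunsOf-uniform R r-pair≡c a∈r)))
             (sym (indexOf-++ˡ r _ a∈r)))
    ... | false | false =
      trans (indexOf-++ʳ r _ (RunsOf-¬memb R ez))
        (trans (cong (length r +_)
                 (refined-uniform Rs (nonStart ∘ ∈-++⁺ʳ b) (Unique-++⁻ʳ b u) pair≡c′ (suc-injective h)))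
          (sym (indexOf-++ʳ r _ (RunsOf-¬memb R ea))))
      where
        pair≡c′ : ∀ {y} → y ∈ concat qs → indexOf qs y ≡ indexOf qs a → minmax P y ≡ c
        pair≡c′ y∈qs hy =
          pair≡c (∈-++⁺ʳ b y∈qs)
            (trans (indexOf-∷-∉ qs (λ y∈b → Unique-++⇒Disjoint b u (y∈b , y∈qs))) (cong suc hy))

  mapM⇒Pointwise : ∀ {f} qs {rs} → mapM f qs ≡ just rs → Pointwise (λ b r → f b ≡ just r) qs rs
  mapM⇒Pointwise [] refl = []
  mapM⇒Pointwise {f} (b ∷ qs) e with f b in fb
  ... | nothing = contradiction e λ ()
  ... | just r with map≡just⁻ {f = r ∷_} (mapM f qs) e
  ...   | rs , e′ , refl = fb ∷ mapM⇒Pointwise qs e′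

  refineStep≡just⁻ : ∀ {qs P′} → refineStep ((ustart ∷ []) ∷ qs) ≡ just P′ →
    ∃ λ rs → Pointwise (RunsOf ((ustart ∷ []) ∷ qs)) qs rs × P′ ≡ (ustart ∷ []) ∷ concat rs
  refineStep≡just⁻ {qs} e
    with map≡just⁻ {f = λ rs → (ustart ∷ []) ∷ concat rs}
           (mapM (refineBlock ((ustart ∷ []) ∷ qs)) qs) e
  ... | rs , e′ , refl = rs , Pointwise.map refineBlock⇒RunsOf (mapM⇒Pointwise qs e′) , refl

  data WellFormed : Partition → Set where
    wellFormed : ∀ {qs} → NonStart qs → Unique (concat qs) → WellFormed ((ustart ∷ []) ∷ qs)

  WellFormed-unique : ∀ {P} → WellFormed P → Unique (concat P)
  WellFormed-unique (wellFormed nonStart u) = All.tabulate (λ x∈ s≡x → nonStart x∈ (sym s≡x)) ∷ u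

  WellFormed-startBlock : ∀ {P z} → WellFormed P → indexOf P z ≡ indexOf P ustart → z ≡ ustart
  WellFormed-startBlock (wellFormed {qs} _ _) = indexOf-start≡0 qs

  record Later (P Q : Partition) : Set where
    field
      <-preserving : ∀ a b → indexOf P a < indexOf P b → indexOf Q a < indexOf Q b
      ∈-concat⁺ : ∀ {x} → x ∈ concat P → x ∈ concat Q
      ∈-concat⁻ : ∀ {x} → x ∈ concat Q → x ∈ concat P

  Later-refl : ∀ {P} → Later P P
  Later-refl = record
    { <-preserving = λ _ _ h → h ; ∈-concat⁺ = λ x∈ → x∈ ; ∈-concat⁻ = λ x∈ → x∈ }

  Later-trans : ∀ {P Q R} → Later P Q → Later Q R → Later P R
  Later-trans PQ QR = record
    { <-preserving = λ a b h → Later.<-preserving QR a b (Later.<-preserving PQ a b h)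
    ; ∈-concat⁺ = λ x∈ → Later.∈-concat⁺ QR (Later.∈-concat⁺ PQ x∈)
    ; ∈-concat⁻ = λ x∈ → Later.∈-concat⁻ PQ (Later.∈-concat⁻ QR x∈)
    }

  record Refines (P P′ : Partition) : Set where
    field
      later : Later P P′
      splitsByPair : ∀ {a b} → a ∈ concat P → indexOf P′ a ≡ indexOf P′ b → minmax P a ≡ minmax P b
      keepsUniform : ∀ {a c} → (∀ {y} → y ∈ concat P → indexOf P y ≡ indexOf P a → minmax P y ≡ c) →
                     ∀ {z} → indexOf P z ≡ indexOf P a → indexOf P′ z ≡ indexOf P′ a

  refineStep-wellFormed : ∀ {P P′} → WellFormed P → refineStep P ≡ just P′ → WellFormed P′
  refineStep-wellFormed (wellFormed {qs} nonStart u) e with refineStep≡just⁻ {qs} e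
  ... | rs , Rs , refl =
    wellFormed (nonStart ∘ Blockwise.refined-∈⁻ Rs) (Blockwise.refined-unique Rs u)

  refineStep-refines : ∀ {P P′} → WellFormed P → refineStep P ≡ just P′ → Refines P P′
  refineStep-refines {P} (wellFormed {qs} nonStart u) e with refineStep≡just⁻ {qs} e
  ... | rs , Rs , refl = record
    { later = record { <-preserving = <-preserving ; ∈-concat⁺ = ∈-concat⁺ ; ∈-concat⁻ = ∈-concat⁻ }
    ; splitsByPair = splitsByPair
    ; keepsUniform = keepsUniform
    }
    where
      open Blockwise

      P′ : Partition
      P′ = (ustart ∷ []) ∷ concat rs

      <-preserving : ∀ a b → indexOf P a < indexOf P b → indexOf P′ a < indexOf P′ b
      <-preserving a b h with a ≟ᵤ ustart | b ≟ᵤ ustart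
      ... | _ | yes refl = contradiction h λ ()
      ... | yes refl | no _ = s≤s z≤n
      ... | no _ | no _ = s≤s (refined-< Rs nonStart a b (s≤s⁻¹ h))

      ∈-concat⁺ : ∀ {x} → x ∈ concat P → x ∈ concat P′
      ∈-concat⁺ (here refl) = here refl
      ∈-concat⁺ (there x∈) = there (refined-∈⁺ Rs nonStart x∈)

      ∈-concat⁻ : ∀ {x} → x ∈ concat P′ → x ∈ concat P
      ∈-concat⁻ (here refl) = here refl
      ∈-concat⁻ (there x∈) = there (refined-∈⁻ Rs x∈)

      splitsByPair : ∀ {a b} → a ∈ concat P → indexOf P′ a ≡ indexOf P′ b → minmax P a ≡ minmax P b
      splitsByPair (here refl) h = cong (minmax P) (sym (indexOf-start≡0 (concat rs) (sym h)))
      splitsByPair {a} {b} (there a∈) h with b ≟ᵤ ustart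
      ... | yes refl = contradiction (trans (sym (indexOf-start (concat rs) (nonStart a∈))) h) λ ()
      ... | no _ =
        refined-samePair Rs nonStart a∈ (suc-injective (trans (sym (indexOf-start (concat rs) (nonStart a∈))) h))

      keepsUniform : ∀ {a c} → (∀ {y} → y ∈ concat P → indexOf P y ≡ indexOf P a → minmax P y ≡ c) →
                     ∀ {z} → indexOf P z ≡ indexOf P a → indexOf P′ z ≡ indexOf P′ a
      keepsUniform {a} pair≡c {z} h with a ≟ᵤ ustart
      ... | yes refl = cong (indexOf P′) (indexOf-start≡0 qs h)
      ... | no _ with z ≟ᵤ ustart
      ...   | yes refl = contradiction h λ ()
      ...   | no _ =
        cong suc (refined-uniform Rs nonStart u
                   (λ y∈ hy → pair≡c (there y∈) (trans (indexOf-start qs (nonStart y∈)) (cong suc hy)))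
                   (suc-injective h))

  hasLabel⇒lam : ∀ {c v} → T (hasLabel c v) → lam v ≡ just c
  hasLabel⇒lam {c} {v} t with lam v
  hasLabel⇒lam {c} {v} () | nothing
  ... | just a with a Fin.≟ c
  ...   | yes refl = refl
  hasLabel⇒lam {c} {v} () | just a | no _

  labelBlock : Fin σ → List U
  labelBlock c = filterᵇ (hasLabel c) nonStartNodes

  initial-wellFormed : WellFormed initial
  initial-wellFormed = wellFormed nonStart unique
    where
      labelBlocks : List (List U)
      labelBlocks = map labelBlock (allFin σ)

      labelOf : ∀ {c v} → v ∈ labelBlock c → lam v ≡ just c
      labelOf v∈ = hasLabel⇒lam (proj₂ (∈-filter⁻ (T? ∘ hasLabel _) {xs = nonStartNodes} v∈))

      nonStart : NonStart (filterᵇ nonEmpty labelBlocks)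
      nonStart x∈ =
        let g , x∈g , g∈ = ∈-concat⁻′ _ x∈
            c , _ , g≡ = ∈-map⁻ labelBlock (proj₁ (∈-filter⁻ (T? ∘ nonEmpty) {xs = labelBlocks} g∈))
        in nonStartNodes-≢ (proj₁ (∈-filter⁻ (T? ∘ hasLabel c) (subst (_ ∈_) g≡ x∈g)))

      disjoint : ∀ {c c′} → c ≢ c′ → Disjoint (labelBlock c) (labelBlock c′)
      disjoint c≢c′ (v∈ , v∈′) = c≢c′ (just-injective (trans (sym (labelOf v∈)) (labelOf v∈′)))

      unique : Unique (concat (filterᵇ nonEmpty labelBlocks))
      unique = Unique.concat⁺
        (Allₚ.filter⁺ (T? ∘ nonEmpty)
          (Allₚ.map⁺ (All.universal (λ _ → Unique.filter⁺ _ Unique-nonStartNodes) (allFin σ))))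
        (AllPairsₚ.filter⁺ (T? ∘ nonEmpty) (AllPairsₚ.map⁺ (AllPairs.map disjoint (Unique.allFin⁺ σ))))

  run-wellFormed : ∀ t {P} → run t ≡ just P → WellFormed P
  run-wellFormed zero refl = initial-wellFormed
  run-wellFormed (suc t) e with >>=≡just⁻ (run t) e
  ... | P , eP , refined = refineStep-wellFormed (run-wellFormed t eP) refined

  run-refines : ∀ t {P P′} → run t ≡ just P → refineStep P ≡ just P′ → Refines P P′
  run-refines t eP = refineStep-refines (run-wellFormed t eP)

  run-later : ∀ t k {P Q} → run t ≡ just P → run (k + t) ≡ just Q → Later P Q
  run-later t zero eP eQ with trans (sym eP) eQ
  ... | refl = Later-refl
  run-later t (suc k) eP eQ with >>=≡just⁻ (run (k + t)) eQ
  ... | Q′ , eQ′ , refined =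
    Later-trans (run-later t k eP eQ′) (Refines.later (run-refines (k + t) eQ′ refined))

  -- Minmax pairs in later partitions

  _⟶_ : U → U → Set
  u ⟶ v = ∃ λ a → (u , a , v) ∈ edges

  ∈-predIndices⁻ : ∀ P v {n} → n ∈ predIndices P v → ∃ λ u → u ⟶ v × n ≡ indexOf P u
  ∈-predIndices⁻ P v n∈ with ∈-mapMaybe⁻ _ edges n∈
  ... | (u , a , w) , e∈ , fires with w ≟ᵤ v
  ...   | yes refl = u , (a , e∈) , sym (just-injective fires)
  ∈-predIndices⁻ P v n∈ | (u , a , w) , e∈ , () | no _

  ∈-predIndices⁺ : ∀ P {u v} → u ⟶ v → indexOf P u ∈ predIndices P v
  ∈-predIndices⁺ P {u} {v} (a , e∈) = ∈-mapMaybe⁺ _ edges e∈ fires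
    where
      fires : (if v ==ᵤ v then just (indexOf P u) else nothing) ≡ just (indexOf P u)
      fires rewrite ==ᵤ-refl v = refl

  KeptBlock : Partition → Partition → U → Set
  KeptBlock P Q u = ∀ {w} → indexOf P w ≡ indexOf P u → indexOf Q w ≡ indexOf Q u

  module Transport {P Q : Partition}
                   (<-preserving : ∀ a b → indexOf P a < indexOf P b → indexOf Q a < indexOf Q b) where

    kept-≤ : ∀ {u w} → KeptBlock P Q u → indexOf P u ≤ indexOf P w → indexOf Q u ≤ indexOf Q w
    kept-≤ {u} {w} kept u≤w with m≤n⇒m<n∨m≡n u≤w
    ... | inj₁ u<w = <⇒≤ (<-preserving u w u<w)
    ... | inj₂ u≡w = ≤-reflexive (sym (kept (sym u≡w)))

    kept-≥ : ∀ {u w} → KeptBlock P Q u → indexOf P w ≤ indexOf P u → indexOf Q w ≤ indexOf Q u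
    kept-≥ {u} {w} kept w≤u with m≤n⇒m<n∨m≡n w≤u
    ... | inj₁ w<u = <⇒≤ (<-preserving w u w<u)
    ... | inj₂ w≡u = ≤-reflexive (kept w≡u)

    minPred-transport : ∀ {u v y} → KeptBlock P Q u → v ⟶ y →
      minL (predIndices P y) ≡ indexOf P u → minL (predIndices Q y) ≡ indexOf Q u
    minPred-transport {u} {y = y} kept v⟶y min≡ =
      let w , w⟶y , w-min = ∈-predIndices⁻ P y (minL-∈ _ (∈-predIndices⁺ P v⟶y))
      in minL-unique _
           (subst (_∈ predIndices Q y) (kept (trans (sym w-min) min≡)) (∈-predIndices⁺ Q w⟶y)) lower
      where
        lower : ∀ {n} → n ∈ predIndices Q y → indexOf Q u ≤ n
        lower n∈ =
          let u′ , u′⟶y , n≡ = ∈-predIndices⁻ Q y n∈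
          in subst (indexOf Q u ≤_) (sym n≡)
               (kept-≤ kept (subst (_≤ indexOf P u′) min≡ (minL-≤ _ (∈-predIndices⁺ P u′⟶y))))

    maxPred-transport : ∀ {u v y} → KeptBlock P Q u → v ⟶ y →
      maxL (predIndices P y) ≡ indexOf P u → maxL (predIndices Q y) ≡ indexOf Q u
    maxPred-transport {u} {y = y} kept v⟶y max≡ =
      let w , w⟶y , w-max = ∈-predIndices⁻ P y (maxL-∈ _ (∈-predIndices⁺ P v⟶y))
      in maxL-unique _
           (subst (_∈ predIndices Q y) (kept (trans (sym w-max) max≡)) (∈-predIndices⁺ Q w⟶y)) upper
      where
        upper : ∀ {n} → n ∈ predIndices Q y → n ≤ indexOf Q u
        upper n∈ =
          let u′ , u′⟶y , n≡ = ∈-predIndices⁻ Q y n∈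
          in subst (_≤ indexOf Q u) (sym n≡)
               (kept-≥ kept (subst (indexOf P u′ ≤_) max≡ (maxL-≥ _ (∈-predIndices⁺ P u′⟶y))))

    minmax-transport : ∀ {x y} → (∀ {u} → u ⟶ x → KeptBlock P Q u) →
      (∃ λ v → v ⟶ x) → (∃ λ v → v ⟶ y) → minmax P y ≡ minmax P x → minmax Q y ≡ minmax Q x
    minmax-transport {x} keptPreds (v , v⟶x) (v′ , v′⟶y) same =
      let umin , umin⟶x , min≡ = ∈-predIndices⁻ P x (minL-∈ _ (∈-predIndices⁺ P v⟶x))
          umax , umax⟶x , max≡ = ∈-predIndices⁻ P x (maxL-∈ _ (∈-predIndices⁺ P v⟶x))
          keptMin = keptPreds umin⟶x
          keptMax = keptPreds umax⟶x
      in cong₂ _,_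
           (trans (minPred-transport keptMin v′⟶y (trans (cong proj₁ same) min≡))
                  (sym (minPred-transport keptMin v⟶x min≡)))
           (trans (maxPred-transport keptMax v′⟶y (trans (cong proj₂ same) max≡))
                  (sym (maxPred-transport keptMax v⟶x max≡)))

  -- Depth

  module Depth (W0 : IsWheelerAutomaton A0) (W1 : IsWheelerAutomaton A1) where

    embed0-path : ∀ {u v k} → Path (NFA.edges A0) u v k → Path edges (embed0 u) (embed0 v) k
    embed0-path here = here
    embed0-path (step p e∈) = step (embed0-path p) (∈-++⁺ˡ (∈-map⁺ _ e∈))

    embed1-path : ∀ {u v k} → Path (NFA.edges A1) u v k → Path edges (embed1 u) (embed1 v) k
    embed1-path here = here
    embed1-path (step p e∈) = step (embed1-path p) (∈-++⁺ʳ _ (∈-map⁺ _ e∈))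

    reachable : ∀ x → ∃ λ k → Path edges ustart x k
    reachable ustart = 0 , here
    reachable (inV0 i) = let k , p = IsWheelerAutomaton.reachable W0 (Fin.suc i) in k , embed0-path p
    reachable (inV1 i) = let k , p = IsWheelerAutomaton.reachable W1 (Fin.suc i) in k , embed1-path p

    nonStart-pred : ∀ {x} → x ≢ ustart → ∃ λ u → u ⟶ x
    nonStart-pred {x} x≢s with reachable x
    ... | zero , here = contradiction refl x≢s
    ... | suc _ , step {w = w} {a = a} _ e∈ = w , a , e∈

    AtDepth : ℕ → U → Set
    AtDepth d x = ∀ k → Path edges ustart x k → k ≡ d

    AtDepth-zero : ∀ {x} → AtDepth 0 x → x ≡ ustart
    AtDepth-zero {x} atDepth with reachable x
    ... | k , p with subst (Path edges ustart x) (atDepth k p) p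
    ...   | here = refl

    AtDepth-suc-≢ : ∀ {d x} → AtDepth (suc d) x → x ≢ ustart
    AtDepth-suc-≢ atDepth refl with () ← atDepth 0 here

    AtDepth-pred : ∀ {d x u} → AtDepth (suc d) x → u ⟶ x → AtDepth d u
    AtDepth-pred atDepth (a , e∈) k p = suc-injective (atDepth (suc k) (step p e∈))

    StableFrom : ℕ → U → Set
    StableFrom r x = ∀ k {P Q} → run r ≡ just P → run (k + r) ≡ just Q → KeptBlock P Q x

    start-stableFrom : ∀ r → StableFrom r ustart
    start-stableFrom r k {Q = Q} eP eQ hz =
      cong (indexOf Q) (WellFormed-startBlock (run-wellFormed r eP) hz)

    stableFrom-suc : ∀ {d r x} → AtDepth (suc d) x → (∀ {u} → u ⟶ x → StableFrom r u) →
      StableFrom (suc r) x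
    stableFrom-suc atDepth keptPreds zero eP eQ hz with trans (sym eP) eQ
    ... | refl = hz
    stableFrom-suc {r = r} {x} atDepth keptPreds (suc k) {P} eP eQ hz
      with >>=≡just⁻ (run r) eP | >>=≡just⁻ (run (k + suc r)) eQ
    ... | P₀ , eP₀ , P₀→P | Q′ , eQ′ , Q′→Q =
      Refines.keepsUniform (run-refines (k + suc r) eQ′ Q′→Q) {a = x} uniform
        (stableFrom-suc atDepth keptPreds k eP eQ′ hz)
      where
        P→Q′ : Later P Q′
        P→Q′ = run-later (suc r) k eP eQ′

        P₀→Q′ : Later P₀ Q′
        P₀→Q′ = Later-trans (Refines.later (run-refines r eP₀ P₀→P)) P→Q′

        x≢s : x ≢ ustart
        x≢s = AtDepth-suc-≢ atDepth

        keptPredsInQ′ : ∀ {u} → u ⟶ x → KeptBlock P₀ Q′ u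
        keptPredsInQ′ u⟶x = keptPreds u⟶x (suc k) eP₀ (subst (λ t → run t ≡ just Q′) (+-suc k r) eQ′)

        -- y shares x's block in P, so it had x's pair in P₀; that pair survives to Q′.
        uniform : ∀ {y} → y ∈ concat Q′ → indexOf Q′ y ≡ indexOf Q′ x → minmax Q′ y ≡ minmax Q′ x
        uniform {y} y∈ hy =
          Transport.minmax-transport {P₀} {Q′} (Later.<-preserving P₀→Q′) keptPredsInQ′
            (nonStart-pred x≢s) (nonStart-pred y≢s)
            (Refines.splitsByPair (run-refines r eP₀ P₀→P) (Later.∈-concat⁻ P₀→Q′ y∈)
              (<-preserving⇒≡-reflecting (indexOf P) (indexOf Q′) (Later.<-preserving P→Q′) y x hy))
          where
            y≢s : y ≢ ustart
            y≢s refl = x≢s (WellFormed-startBlock (run-wellFormed (k + suc r) eQ′) (sym hy))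

    atDepth-stableFrom : ∀ d {x} → AtDepth d x → ∀ {r} → d ≤ r → StableFrom r x
    atDepth-stableFrom zero atDepth {r} _ =
      subst (StableFrom r) (sym (AtDepth-zero atDepth)) (start-stableFrom r)
    atDepth-stableFrom (suc d) atDepth {suc r} (s≤s d≤r) =
      stableFrom-suc atDepth (λ u⟶x → atDepth-stableFrom d (AtDepth-pred atDepth u⟶x) d≤r)

    block-survives : ∀ {d r P B u} → run r ≡ just P → B ∈ P → u ∈ B → AtDepth d u → d ≤ r →
      ∀ k {Q} → run (k + r) ≡ just Q → ∃ λ B′ → B′ ∈ Q × (∀ {v} → v ∈ B → v ∈ B′)
    block-survives {d} {r} {P} {B} {u} eP B∈P u∈B atDepth d≤r k {Q} eQ =
      let B′ , B′∈Q , _ , sameAsU = sameIndex⇒sameBlock Q (∈-concat⁺ (∈-concat⁺′ u∈B B∈P))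
      in B′ , B′∈Q ,
         λ v∈B → sameAsU (∈-concat⁺ (∈-concat⁺′ v∈B B∈P)) (keptU (sameIndexAsU v∈B))
      where
        open Later (run-later r k eP eQ)

        keptU : KeptBlock P Q u
        keptU = atDepth-stableFrom d atDepth d≤r k eP eQ

        sameIndexAsU : ∀ {v} → v ∈ B → indexOf P v ≡ indexOf P u
        sameIndexAsU v∈B = sameBlock⇒sameIndex P (WellFormed-unique (run-wellFormed r eP)) B∈P v∈B u∈B

lemma9 : ∀ {σ} (A0 A1 : NFA σ) → IsWheelerAutomaton A0 → IsWheelerAutomaton A1 →
    ∀ (j j' : ℕ) (P : Union.Partition A0 A1) → 1 ≤ j → j' < j →
    Union.partitionAtIteration A0 A1 j ≡ just P →
    ∀ (B : List (Union.U A0 A1)) → B ∈ P → NonSingleton B →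
    (∀ v → v ∈ B → ∀ k → Path (Union.edges A0 A1) (ustart {NFA.n A0} {NFA.n A1}) v k → k ≡ j') →
    ∀ t Q → Union.run A0 A1 ((j ∸ 1) + t) ≡ just Q →
    Σ (List (Union.U A0 A1)) λ B' → B' ∈ Q × (∀ v → v ∈ B → v ∈ B')
lemma9 A0 A1 W0 W1 (suc j₀) j′ P _ (s≤s j′≤j₀) eP B B∈P (u , _ , u∈B , _) depth t Q eQ =
  let B′ , B′∈Q , B⊆B′ = block-survives eP B∈P u∈B (depth u u∈B) j′≤j₀ t eQ′
  in B′ , B′∈Q , λ v → B⊆B′
  where
    open Refinement.Depth A0 A1 W0 W1

    eQ′ : Union.run A0 A1 (t + j₀) ≡ just Q
    eQ′ = subst (λ n → Union.run A0 A1 n ≡ just Q) (+-comm j₀ t) eQ
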